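{- For every positive integer $t$, $b(0,1;t)=t+1$.
   Context: A family of sets is a set $F$ of sets. $F$ has the $[0,1]$-property if $A\cap B=\emptyset$ for all distinct $A,B\in F$. A set $X$ with $|X|\le t$ is a $t$-transversal of $F$ if it meets every member of $F$. $F$ has the $t$-property if for every $A\in F$ the family $F\setminus\{A\}$ has a $t$-transversal $X$ with $X\cap A=\emptyset$. $b(0,1;t)$ is the supremum of $|F|$ over all families $F$ with the $[0,1]$-property and the $t$-property. -}

module Defs where

open import Level using (0ℓ)
open import Data.Nat using (ℕ; suc; _≤_)
open import Data.Fin using (Fin)
open import Data.List using (List; length)
open import Data.List.Relation.Unary.All using (All)
open import Data.List.Relation.Unary.Any using (Any)
open import Data.Product using (Σ; _×_; ∃)
open import Relation.Binary.PropositionalEquality using (_≡_; _≢_)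
open import Relation.Nullary using (¬_)
open import Relation.Unary using (Pred; _≐_)
open import Function.Definitions using (Injective)

-- Members of a family (a set of sets) are distinct,
-- so we require the indexing to be injective up to extensional equality.
IsFamily : {U I : Set} → (I → Pred U 0ℓ) → Set
IsFamily {I = I} A = ∀ (i j : I) → A i ≐ A j → i ≡ j

ZeroOneProperty : {U I : Set} → (I → Pred U 0ℓ) → Set
ZeroOneProperty {U} {I} A = ∀ (i j : I) → i ≢ j → ∀ (x : U) → ¬ (A i x × A j x)

-- X (a finite set, listed with possible repetitions, so |X| ≤ length X)
-- is a t-transversal of F ∖ {A i} disjoint from A i.
TransversalAvoiding : {U I : Set} → (I → Pred U 0ℓ) → ℕ → I → List U → Set
TransversalAvoiding {I = I} A t i X =
  (length X ≤ t) × All (λ x → ¬ A i x) X × (∀ (j : I) → j ≢ i → Any (A j) X)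

TProperty : {U I : Set} → (I → Pred U 0ℓ) → ℕ → Set
TProperty {U} {I} A t = ∀ (i : I) → Σ (List U) (λ X → TransversalAvoiding A t i X)

AtMost : Set → ℕ → Set
AtMost I n = ¬ Σ (Fin (suc n) → I) Injective′
  where
  Injective′ : (Fin (suc n) → I) → Set
  Injective′ f = Injective _≡_ _≡_ f

-- Upper bound.  Let F have the [0,1]-property and the t-property and suppose
-- F had t + 2 distinct members A₀, …, A_{t+1}.  The t-property gives a list X
-- of length ≤ t meeting A₁, …, A_{t+1}.  These t + 1 members are pairwise
-- disjoint, so the positions in X at which they are met are pairwise distinct;
-- hence t + 1 ≤ length X ≤ t, a contradiction.
--
-- Lower bound.  The singletons {0}, …, {t} of Fin (t + 1) form a family with
-- the [0,1]-property, and for each i the t other points form a t-transversal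
-- of the remaining singletons avoiding {i}.
module Submission where

open import Defs
open import Level using (0ℓ)
open import Data.Nat using (ℕ; suc; _≤_)
open import Data.Nat.Properties using (≤-reflexive; ≤⇒≯)
open import Data.Fin using (Fin; zero; suc; punchIn; punchOut; _≟_)
open import Data.Fin.Properties using (injective⇒≤; suc-injective; punchInᵢ≢i; punchIn-punchOut)
open import Data.Product using (Σ; _×_; _,_)
open import Data.List using (List; length; tabulate; lookup)
open import Data.List.Properties using (length-tabulate)
open import Data.List.Relation.Unary.All using (All)
open import Data.List.Relation.Unary.Any using (Any; index)
import Data.List.Relation.Unary.Any.Properties as Any
import Data.List.Relation.Unary.All.Properties as All
open import Relation.Binary.PropositionalEquality using (_≡_; _≢_; refl; sym; trans; subst)
open import Relation.Nullary using (¬_; yes; no)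
open import Data.Empty using (⊥-elim)
open import Relation.Unary using (Pred)
open import Function.Definitions using (Injective)

-- Pigeonhole for transversals: if n pairwise disjoint sets B₀, …, B_{n-1}
-- each meet the list X, then n ≤ length X, because sending each Bₖ to a
-- position of X where it is met is injective.
disjoint-hitters-≤-length : {U : Set} {n : ℕ} (B : Fin n → Pred U 0ℓ) (X : List U) →
  ZeroOneProperty B → (∀ k → Any (B k) X) → n ≤ length X
disjoint-hitters-≤-length {n = n} B X disjoint hits = injective⇒≤ position-injective
  where
  position : Fin n → Fin (length X)
  position k = index (hits k)

  met-at : ∀ k → B k (lookup X (position k))
  met-at k = Any.lookup-index (hits k)

  position-injective : Injective _≡_ _≡_ position
  position-injective {k} {l} same with k ≟ l
  ... | yes k≡l = k≡l
  ... | no k≢l = ⊥-elim (disjoint k l k≢l _ (met-at k , shared))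
    where
    shared : B l (lookup X (position k))
    shared = subst (λ p → B l (lookup X p)) (sym same) (met-at l)

upper-bound : (t : ℕ) (U I : Set) (A : I → Pred U 0ℓ) →
  IsFamily A → ZeroOneProperty A → TProperty A t → AtMost I (suc t)
upper-bound t U I A _ disjoint tprop (f , f-injective) with tprop (f zero)
... | X , length≤t , _ , meets =
  ≤⇒≯ length≤t (disjoint-hitters-≤-length (λ k → A (f (suc k))) X others-disjoint others-hit)
  where
  others-distinct : ∀ k → f (suc k) ≢ f zero
  others-distinct k e with f-injective e
  ... | ()

  others-disjoint : ZeroOneProperty (λ k → A (f (suc k)))
  others-disjoint k l k≢l = disjoint _ _ (λ e → k≢l (suc-injective (f-injective e)))

  others-hit : ∀ k → Any (A (f (suc k))) X
  others-hit k = meets (f (suc k)) (others-distinct k)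

singleton : {n : ℕ} → Fin n → Pred (Fin n) 0ℓ
singleton i x = x ≡ i

singleton-isFamily : {n : ℕ} → IsFamily (singleton {n})
singleton-isFamily i j (i∈j , _) = i∈j refl

singleton-disjoint : {n : ℕ} → ZeroOneProperty (singleton {n})
singleton-disjoint i j i≢j x (x≡i , x≡j) = i≢j (trans (sym x≡i) x≡j)

-- The singletons of Fin (n + 1) have the n-property: the n points other
-- than i, listed as punchIn i applied to Fin n, avoid {i} and meet every
-- other singleton {j} (namely at j itself, which is punchIn i (punchOut j)).
singleton-tProperty : (n : ℕ) → TProperty (singleton {suc n}) n
singleton-tProperty n i =
  others , length-others , others-avoid-i , others-meet
  where
  others : List (Fin (suc n))
  others = tabulate (punchIn i)

  length-others : length others ≤ n
  length-others = ≤-reflexive (length-tabulate (punchIn i))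

  others-avoid-i : All (λ x → ¬ singleton i x) others
  others-avoid-i = All.tabulate⁺ (punchInᵢ≢i i)

  others-meet : ∀ j → j ≢ i → Any (singleton j) others
  others-meet j j≢i = Any.tabulate⁺ (punchOut i≢j) (punchIn-punchOut i≢j)
    where
    i≢j : i ≢ j
    i≢j e = j≢i (sym e)

lemma1 : (t : ℕ) → 1 ≤ t →
    ((U I : Set) (A : I → Pred U 0ℓ) → IsFamily A → ZeroOneProperty A → TProperty A t → AtMost I (suc t))
    × Σ Set (λ U → Σ (Fin (suc t) → Pred U 0ℓ) (λ A → IsFamily A × ZeroOneProperty A × TProperty A t))
lemma1 t _ =
  upper-bound t ,
  Fin (suc t) , singleton , singleton-isFamily , singleton-disjoint , singleton-tProperty t
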